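{- For every positive integer $m$ there is a constant $C=C(m)$ such that for every integer $n\ge m$, every latin square of order $n$ has at most $C\,n^{\sqrt{2m}+2}$ subsquares of order $m$.
   Context: A latin square of order $n$ is an $n\times n$ matrix on $n$ symbols in which each symbol occurs exactly once in each row and each column. A subsquare of a latin square $L$ is a submatrix of $L$ (obtained by selecting some set of rows and some set of columns, not necessarily contiguous) that is itself a latin square; its order is its number of rows. -}

module Defs where

open import Data.Nat using (ℕ)
open import Data.Fin using (Fin)
open import Data.Fin.Subset using (Subset; _∈_; ∣_∣)
open import Data.Product using (∃!; _×_; Σ; _,_)
open import Relation.Binary.PropositionalEquality using (_≡_)

record LatinSquare (n : ℕ) : Set where
  field
    entry  : Fin n → Fin n → Fin n
    rowLat : ∀ (i s : Fin n) → ∃! _≡_ (λ j → entry i j ≡ s)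
    colLat : ∀ (j s : Fin n) → ∃! _≡_ (λ i → entry i j ≡ s)

open LatinSquare public

IsSubsquare : ∀ {n} → LatinSquare n → ℕ → Subset n × Subset n → Set
IsSubsquare {n} L m (R , S) =
  ∣ R ∣ ≡ m × ∣ S ∣ ≡ m ×
  Σ (Subset n) λ T →
    ∣ T ∣ ≡ m ×
    (∀ r c → r ∈ R → c ∈ S → entry L r c ∈ T) ×
    (∀ r t → r ∈ R → t ∈ T → ∃! _≡_ (λ c → c ∈ S × entry L r c ≡ t)) ×
    (∀ c t → c ∈ S → t ∈ T → ∃! _≡_ (λ r → r ∈ R × entry L r c ≡ t))

-- A subsquare Q of order m is determined by one of its columns c₀ together with
-- K + 1 of its rows, where 2^K ≤ m < 2^(K+1).  Call a triple (A, B, U) of rows,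
-- columns and symbols closed in Q if it is closed under the quasigroup operations
-- of Q; such triples are stable under intersection.  Starting from one row, keep
-- adding a row of Q missed by some closed triple that contains c₀ and the rows
-- chosen so far.  Each addition doubles the least number of symbols of such a
-- triple, so after K + 1 rows every closed triple containing them contains all
-- rows (hence all columns) of Q.  Two subsquares with the same column and rows
-- contain each other, since their intersection is closed in both; hence there
-- are at most n^(K+2) subsquares of order m, and K² ≤ 2·2^K ≤ 2m gives
-- K ≤ √(2m).

module Submission where

open import Defs
open import Data.Nat using (ℕ; _≤_; _*_; _+_; _^_)
open import Data.Product using (∃; _×_)
open import Data.List using (List; length)
open import Data.List.Relation.Unary.All using (All)
open import Data.List.Relation.Unary.Unique.Propositional using (Unique)
open import Data.Fin.Subset using (Subset)

open import Data.Nat using (suc; zero; _<_; z≤n; s≤s; >-nonZero)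
open import Data.Nat.Properties
open import Data.Nat.Tactic.RingSolver using (solve)
open import Data.Product using (Σ; _,_; proj₁; proj₂; map₂)
open import Data.Sum using (_⊎_; inj₁; inj₂)
open import Data.List using ([]; _∷_; [_]; _++_; map)
open import Data.List.Properties using (length-++; length-map; length-tabulate)
open import Data.List.Membership.Propositional using () renaming (_∈_ to _∈ₗ_)
open import Data.List.Membership.Propositional.Properties
  using (∈-∃++; ∈-++⁻; ∈-++⁺ˡ; ∈-++⁺ʳ; ∈-map⁺; ∈-map⁻; ∈-allFin)
open import Data.List.Relation.Unary.Any using (here; there)
open import Data.Vec.Base using (here; there)
open import Data.List.Relation.Unary.All as All using ([]; _∷_)
import Data.List.Relation.Unary.All.Properties as All
open import Data.List.Relation.Unary.AllPairs using ([]; _∷_)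
open import Data.List.Relation.Unary.Unique.Propositional.Properties using (++⁺; map⁺)
open import Data.List.Relation.Binary.Disjoint.Propositional using (Disjoint)
open import Data.Fin using (Fin; zero; suc; combine)
open import Data.Fin.Properties using (all?; any?; combine-injective)
open import Data.Fin.Subset using (_∈_; _∉_; _⊆_; _∩_; ∣_∣; inside; outside)
open import Data.Fin.Subset.Properties using (_∈?_; _⊆?_; x∈p∩q⁺; x∈p∩q⁻; ⊆-antisym; anySubset?)
open import Data.Vec using (Vec; []; _∷_)
open import Data.Vec.Relation.Unary.All as Vecᴬ using ([]; _∷_)
open import Function using (_∘_; id)
open import Relation.Nullary using (Dec; yes; no; ¬_; contradiction; ¬?)
open import Relation.Nullary.Decidable using (_×-dec_; _→-dec_)
open import Relation.Binary.PropositionalEquality using (_≡_; refl; sym; trans; cong; cong₂; subst; module ≡-Reasoning)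

module _ {A B : Set} {P : A → Set} where

  injection⇒length≤ : (f : ∀ {x} → P x → B) →
    (∀ {x y} (px : P x) (py : P y) → f px ≡ f py → x ≡ y) →
    ∀ {xs ys} → Unique xs → All P xs → (∀ {x} → x ∈ₗ xs → (px : P x) → f px ∈ₗ ys) →
    length xs ≤ length ys
  injection⇒length≤ f f-inj {[]} _ _ _ = z≤n
  injection⇒length≤ f f-inj {x ∷ xs} (x∉xs ∷ xs-unique) (px ∷ pxs) f∈ys
    with us , vs , refl ← ∈-∃++ (f∈ys (here refl) px) = begin
      suc (length xs)           ≤⟨ s≤s (injection⇒length≤ f f-inj xs-unique pxs f∈us++vs) ⟩
      suc (length (us ++ vs))   ≡⟨ cong suc (length-++ us) ⟩
      suc (length us + length vs) ≡⟨ sym (+-suc (length us) (length vs)) ⟩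
      length us + length (f px ∷ vs) ≡⟨ sym (length-++ us) ⟩
      length (us ++ f px ∷ vs)  ∎
    where
      open ≤-Reasoning
      f∈us++vs : ∀ {y} → y ∈ₗ xs → (py : P y) → f py ∈ₗ us ++ vs
      f∈us++vs y∈xs py with ∈-++⁻ us (f∈ys (there y∈xs) py)
      ... | inj₁ ∈us         = ∈-++⁺ˡ ∈us
      ... | inj₂ (here eq)   = contradiction (sym (f-inj py px eq)) (All.lookup x∉xs y∈xs)
      ... | inj₂ (there ∈vs) = ∈-++⁺ʳ us ∈vs

elements : ∀ {n} → Subset n → List (Fin n)
elements []            = []
elements (inside ∷ p)  = zero ∷ map suc (elements p)
elements (outside ∷ p) = map suc (elements p)

length-elements : ∀ {n} (p : Subset n) → length (elements p) ≡ ∣ p ∣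
length-elements []            = refl
length-elements (inside ∷ p)  = cong suc (trans (length-map suc (elements p)) (length-elements p))
length-elements (outside ∷ p) = trans (length-map suc (elements p)) (length-elements p)

∈-elements : ∀ {n} {x : Fin n} {p : Subset n} → x ∈ p → x ∈ₗ elements p
∈-elements {p = inside ∷ p}  here        = here refl
∈-elements {p = inside ∷ p}  (there x∈p) = there (∈-map⁺ suc (∈-elements x∈p))
∈-elements {p = outside ∷ p} (there x∈p) = ∈-map⁺ suc (∈-elements x∈p)

HasAtLeast : ∀ {n} → ℕ → Subset n → Set
HasAtLeast {n} k p = ∃ λ (xs : List (Fin n)) → Unique xs × All (_∈ p) xs × k ≤ length xs

hasAtLeast⇒≤∣p∣ : ∀ {n k} {p : Subset n} → HasAtLeast k p → k ≤ ∣ p ∣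
hasAtLeast⇒≤∣p∣ {k = k} {p} (xs , xs-unique , xs⊆p , k≤) = begin
  k                      ≤⟨ k≤ ⟩
  length xs              ≤⟨ injection⇒length≤ {P = _∈ p} (λ {x} _ → x) (λ _ _ → id) xs-unique xs⊆p
                              (λ _ → ∈-elements) ⟩
  length (elements p)    ≡⟨ length-elements p ⟩
  ∣ p ∣                  ∎
  where open ≤-Reasoning

nonempty : ∀ {n} (p : Subset n) → 1 ≤ ∣ p ∣ → ∃ λ x → x ∈ p
nonempty (inside ∷ p)  _   = zero , here
nonempty (outside ∷ p) 1≤ = let x , x∈p = nonempty p 1≤ in suc x , there x∈p

encode : ∀ {n k} → Vec (Fin n) k → Fin (n ^ k)
encode []       = zero
encode (x ∷ xs) = combine x (encode xs)

encode-injective : ∀ {n k} {xs ys : Vec (Fin n) k} → encode xs ≡ encode ys → xs ≡ ys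
encode-injective {xs = []}     {[]}     _  = refl
encode-injective {xs = x ∷ xs} {y ∷ ys} eq with refl , eq′ ← combine-injective x (encode xs) y (encode ys) eq
  = cong (x ∷_) (encode-injective eq′)

n<2*n : ∀ n → 1 ≤ n → n < 2 * n
n<2*n n 1≤n = subst (n <_) (cong (n +_) (sym (+-identityʳ n))) (m<m+n n 1≤n)

∃2^K≤m<2^[1+K] : ∀ m → 1 ≤ m → ∃ λ K → 2 ^ K ≤ m × m < 2 ^ suc K
∃2^K≤m<2^[1+K] 1 _ = 0 , ≤-refl , s≤s (s≤s z≤n)
∃2^K≤m<2^[1+K] (suc m@(suc _)) _ with ∃2^K≤m<2^[1+K] m (s≤s z≤n)
... | K , 2^K≤m , m<2^[1+K] with m≤n⇒m<n∨m≡n m<2^[1+K]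
...   | inj₁ 1+m<2^[1+K] = K , m≤n⇒m≤1+n 2^K≤m , 1+m<2^[1+K]
...   | inj₂ 1+m≡2^[1+K] = suc K , ≤-reflexive (sym 1+m≡2^[1+K]) ,
        subst (suc m <_) (cong (2 *_) 1+m≡2^[1+K]) (n<2*n (suc m) (s≤s z≤n))

1+2k≤2^[1+k] : ∀ k → 1 + 2 * k ≤ 2 ^ suc k
1+2k≤2^[1+k] zero    = s≤s z≤n
1+2k≤2^[1+k] (suc k) = begin
  1 + 2 * suc k               ≡⟨ solve [ k ] ⟩
  2 + (1 + 2 * k)             ≤⟨ +-mono-≤ (^-monoʳ-≤ 2 (s≤s (z≤n {k}))) (1+2k≤2^[1+k] k) ⟩
  2 ^ suc k + 2 ^ suc k       ≡⟨ cong (2 ^ suc k +_) (sym (+-identityʳ _)) ⟩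
  2 ^ suc (suc k)             ∎
  where open ≤-Reasoning

k*k≤2^[1+k] : ∀ k → k * k ≤ 2 ^ suc k
k*k≤2^[1+k] zero    = z≤n
k*k≤2^[1+k] (suc k) = begin
  suc k * suc k               ≡⟨ solve [ k ] ⟩
  k * k + (1 + 2 * k)         ≤⟨ +-mono-≤ (k*k≤2^[1+k] k) (1+2k≤2^[1+k] k) ⟩
  2 ^ suc k + 2 ^ suc k       ≡⟨ cong (2 ^ suc k +_) (sym (+-identityʳ _)) ⟩
  2 ^ suc (suc k)             ∎
  where open ≤-Reasoning

m*m≤n*n⇒m≤n : ∀ {m n} → m * m ≤ n * n → m ≤ n
m*m≤n*n⇒m≤n m*m≤n*n = ≮⇒≥ λ n<m → <⇒≱ (*-mono-< n<m n<m) m*m≤n*n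

exponent-bound : ∀ {m K p q} → 2 ^ K ≤ m → 2 * m * (q * q) ≤ p * p → (2 + K) * q ≤ p + 2 * q
exponent-bound {m} {K} {p} {q} 2^K≤m 2mq²≤p² = begin
  (2 + K) * q   ≡⟨ *-distribʳ-+ q 2 K ⟩
  2 * q + K * q ≤⟨ +-monoʳ-≤ (2 * q) (m*m≤n*n⇒m≤n Kq*Kq≤p*p) ⟩
  2 * q + p     ≡⟨ +-comm (2 * q) p ⟩
  p + 2 * q     ∎
  where
    open ≤-Reasoning
    Kq*Kq≤p*p : K * q * (K * q) ≤ p * p
    Kq*Kq≤p*p = begin
      K * q * (K * q)   ≡⟨ [m*n]*[o*p]≡[m*o]*[n*p] K q K q ⟩
      K * K * (q * q)   ≤⟨ *-monoˡ-≤ (q * q) (≤-trans (k*k≤2^[1+k] K) (*-monoʳ-≤ 2 2^K≤m)) ⟩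
      2 * m * (q * q)   ≤⟨ 2mq²≤p² ⟩
      p * p             ∎

module _ {n : ℕ} (L : LatinSquare n) where

  entry-cancelˡ : ∀ i {a b} → entry L i a ≡ entry L i b → a ≡ b
  entry-cancelˡ i {b = b} eq =
    let _ , _ , unique = rowLat L i (entry L i b) in trans (sym (unique eq)) (unique refl)

  entry-cancelʳ : ∀ j {a b} → entry L a j ≡ entry L b j → a ≡ b
  entry-cancelʳ j {b = b} eq =
    let _ , _ , unique = colLat L j (entry L b j) in trans (sym (unique eq)) (unique refl)

  column-of : Fin n → Fin n → Fin n
  column-of i s = proj₁ (rowLat L i s)

  entry-column-of : ∀ i s → entry L i (column-of i s) ≡ s
  entry-column-of i s = proj₁ (proj₂ (rowLat L i s))

record LatinSubmatrix {n : ℕ} (L : LatinSquare n) (R S : Subset n) : Set where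
  field
    symbols       : Subset n
    entry∈symbols : ∀ {r c} → r ∈ R → c ∈ S → entry L r c ∈ symbols
    row-covers    : ∀ {r t} → r ∈ R → t ∈ symbols → ∃ λ c → c ∈ S × entry L r c ≡ t
    column-covers : ∀ {c t} → c ∈ S → t ∈ symbols → ∃ λ r → r ∈ R × entry L r c ≡ t

  column∈S : ∀ {r c} → r ∈ R → entry L r c ∈ symbols → c ∈ S
  column∈S {r} r∈R t∈T =
    let c′ , c′∈S , eq = row-covers r∈R t∈T in subst (_∈ S) (entry-cancelˡ L r eq) c′∈S

  row∈R : ∀ {r c} → c ∈ S → entry L r c ∈ symbols → r ∈ R
  row∈R {c = c} c∈S t∈T =
    let r′ , r′∈R , eq = column-covers c∈S t∈T in subst (_∈ R) (entry-cancelʳ L c eq) r′∈R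

isSubsquare⇒latinSubmatrix : ∀ {n m R S} (L : LatinSquare n) →
                             IsSubsquare L m (R , S) → LatinSubmatrix L R S
isSubsquare⇒latinSubmatrix _ (_ , _ , T , _ , entry∈T , row , column) = record
  { symbols       = T
  ; entry∈symbols = entry∈T _ _
  ; row-covers    = λ r∈R t∈T → map₂ proj₁ (row _ _ r∈R t∈T)
  ; column-covers = λ c∈S t∈T → map₂ proj₁ (column _ _ c∈S t∈T)
  }

module Closure {n : ℕ} {L : LatinSquare n} {R S : Subset n} (Q : LatinSubmatrix L R S) where
  open LatinSubmatrix Q

  -- (A, B, U) is closed under the quasigroup operations of Q: A ∘ B ⊆ U ⊆ T, and for
  -- a ∈ A, b ∈ B the solutions in Q of a ∘ x ∈ U and y ∘ b ∈ U lie in B and A.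
  Closed : Subset n → Subset n → Subset n → Set
  Closed A B U = U ⊆ symbols
               × (∀ r c → r ∈ A → c ∈ B → entry L r c ∈ U)
               × (∀ r c → r ∈ A → c ∈ S → entry L r c ∈ U → c ∈ B)
               × (∀ r c → c ∈ B → r ∈ R → entry L r c ∈ U → r ∈ A)

  closed? : ∀ A B U → Dec (Closed A B U)
  closed? A B U = U ⊆? symbols
    ×-dec all? (λ r → all? λ c → r ∈? A →-dec c ∈? B →-dec entry L r c ∈? U)
    ×-dec all? (λ r → all? λ c → r ∈? A →-dec c ∈? S →-dec entry L r c ∈? U →-dec c ∈? B)
    ×-dec all? (λ r → all? λ c → c ∈? B →-dec r ∈? R →-dec entry L r c ∈? U →-dec r ∈? A)

  symbols-closed : Closed R S symbols
  symbols-closed = id , (λ _ _ → entry∈symbols) , (λ _ _ _ c∈S _ → c∈S) , (λ _ _ _ r∈R _ → r∈R)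

  ∩-closed : ∀ {A B U A′ B′ U′} → Closed A B U → Closed A′ B′ U′ →
             Closed (A ∩ A′) (B ∩ B′) (U ∩ U′)
  ∩-closed {A} {B} {U} {A′} {B′} {U′} (U⊆T , entry∈U , col , row) (_ , entry∈U′ , col′ , row′) =
      (λ t∈ → U⊆T (proj₁ (x∈p∩q⁻ U U′ t∈)))
    , (λ r c r∈ c∈ → let r∈A , r∈A′ = x∈p∩q⁻ A A′ r∈ ; c∈B , c∈B′ = x∈p∩q⁻ B B′ c∈
                     in x∈p∩q⁺ (entry∈U r c r∈A c∈B , entry∈U′ r c r∈A′ c∈B′))
    , (λ r c r∈ c∈S t∈ → let r∈A , r∈A′ = x∈p∩q⁻ A A′ r∈ ; t∈U , t∈U′ = x∈p∩q⁻ U U′ t∈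
                         in x∈p∩q⁺ (col r c r∈A c∈S t∈U , col′ r c r∈A′ c∈S t∈U′))
    , (λ r c c∈ r∈R t∈ → let c∈B , c∈B′ = x∈p∩q⁻ B B′ c∈ ; t∈U , t∈U′ = x∈p∩q⁻ U U′ t∈
                         in x∈p∩q⁺ (row r c c∈B r∈R t∈U , row′ r c c∈B′ r∈R t∈U′))

  -- The symbol in row g and column c also occurs in column c₀, in a row of R ⊆ A.
  rows⊆⇒columns⊆ : ∀ {A B U g c₀} → Closed A B U → g ∈ R → g ∈ A → c₀ ∈ S → c₀ ∈ B →
                   R ⊆ A → S ⊆ B
  rows⊆⇒columns⊆ {U = U} {g} {c₀} (_ , entry∈U , col , _) g∈R g∈A c₀∈S c₀∈B R⊆A {c} c∈S =
    let r , r∈R , eq = column-covers c₀∈S (entry∈symbols g∈R c∈S)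
    in col g c g∈A c∈S (subst (_∈ U) eq (entry∈U r c₀ (R⊆A r∈R) c₀∈B))

  -- Sending t to the entry of row r in the column where t sits in row g maps the
  -- common symbols injectively into U′ ∖ U.
  doubling : ∀ {A B U A′ B′ U′ g r k} → Closed A B U → Closed A′ B′ U′ →
             g ∈ R → g ∈ A → g ∈ A′ → r ∈ R → r ∉ A → r ∈ A′ →
             HasAtLeast k (U ∩ U′) → HasAtLeast (2 * k) U′
  doubling {U = U} {U′ = U′} {g = g} {r = r} {k = k} (U⊆T , _ , col , row) (_ , entry∈U′ , col′ , _)
           g∈R g∈A g∈A′ r∈R r∉A r∈A′ (ts , ts-unique , ts⊆U∩U′ , k≤∣ts∣) =
    ts ++ map ν ts ,
    ++⁺ ts-unique (map⁺ ν-injective ts-unique) disjoint ,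
    All.++⁺ (All.map (proj₂ ∘ x∈p∩q⁻ U U′) ts⊆U∩U′) (All.map⁺ (All.map (proj₁ ∘ ν-escapes) ts⊆U∩U′)) ,
    bound
    where
      ν : Fin n → Fin n
      ν t = entry L r (column-of L g t)

      ν-injective : ∀ {s t} → ν s ≡ ν t → s ≡ t
      ν-injective {s} {t} eq = begin
        s                          ≡⟨ sym (entry-column-of L g s) ⟩
        entry L g (column-of L g s) ≡⟨ cong (entry L g) (entry-cancelˡ L r eq) ⟩
        entry L g (column-of L g t) ≡⟨ entry-column-of L g t ⟩
        t                          ∎
        where open ≡-Reasoning

      in-row-g : ∀ {t V} → t ∈ V → entry L g (column-of L g t) ∈ V
      in-row-g {t} = subst (_∈ _) (sym (entry-column-of L g t))

      ν-escapes : ∀ {t} → t ∈ U ∩ U′ → ν t ∈ U′ × ν t ∉ U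
      ν-escapes {t} t∈ =
        let t∈U , t∈U′ = x∈p∩q⁻ U U′ t∈
            c = column-of L g t
            c∈S = column∈S g∈R (U⊆T (in-row-g t∈U))
        in entry∈U′ r c r∈A′ (col′ g c g∈A′ c∈S (in-row-g t∈U′))
         , λ νt∈U → r∉A (row r c (col g c g∈A c∈S (in-row-g t∈U)) r∈R νt∈U)

      disjoint : Disjoint ts (map ν ts)
      disjoint (v∈ts , v∈νts) with ∈-map⁻ ν v∈νts
      ... | t , t∈ts , refl =
        proj₂ (ν-escapes (All.lookup ts⊆U∩U′ t∈ts)) (proj₁ (x∈p∩q⁻ U U′ (All.lookup ts⊆U∩U′ v∈ts)))

      bound : 2 * k ≤ length (ts ++ map ν ts)
      bound = begin
        2 * k                          ≤⟨ *-monoʳ-≤ 2 k≤∣ts∣ ⟩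
        length ts + (length ts + 0)    ≡⟨ cong (length ts +_) (trans (+-identityʳ _) (sym (length-map ν ts))) ⟩
        length ts + length (map ν ts)  ≡⟨ sym (length-++ ts) ⟩
        length (ts ++ map ν ts)        ∎
        where open ≤-Reasoning

  module Generation (c₀ : Fin n) where

    Contains : ∀ {k} → Vec (Fin n) k → Subset n → Subset n → Set
    Contains G A B = Vecᴬ.All (_∈ A) G × c₀ ∈ B

    Generates : ∀ {k} → Vec (Fin n) k → Set
    Generates G = ∀ A B U → Closed A B U → Contains G A B → R ⊆ A

    Escapes : ∀ {k} → Vec (Fin n) k → Set
    Escapes G = ∃ λ A → ∃ λ B → ∃ λ U → Closed A B U × Contains G A B × ∃ λ r → r ∈ R × r ∉ A

    escapes? : ∀ {k} (G : Vec (Fin n) k) → Dec (Escapes G)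
    escapes? G = anySubset? λ A → anySubset? λ B → anySubset? λ U →
      closed? A B U ×-dec (Vecᴬ.all? (_∈? A) G ×-dec c₀ ∈? B) ×-dec any? λ r → r ∈? R ×-dec ¬? (r ∈? A)

    ¬escapes⇒generates : ∀ {k} {G : Vec (Fin n) k} → ¬ Escapes G → Generates G
    ¬escapes⇒generates ¬escapes A B U closed contains {r} r∈R with r ∈? A
    ... | yes r∈A = r∈A
    ... | no  r∉A = contradiction (A , B , U , closed , contains , r , r∈R , r∉A) ¬escapes

    ClosuresHave : ∀ {k} → ℕ → Vec (Fin n) k → Set
    ClosuresHave s G = ∀ A B U → Closed A B U → Contains G A B → HasAtLeast s U

    closuresHave⇒≤∣symbols∣ : ∀ {k s} {G : Vec (Fin n) k} → c₀ ∈ S → Vecᴬ.All (_∈ R) G →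
                               ClosuresHave s G → s ≤ ∣ symbols ∣
    closuresHave⇒≤∣symbols∣ c₀∈S G⊆R closures =
      hasAtLeast⇒≤∣p∣ (closures R S symbols symbols-closed (G⊆R , c₀∈S))

    ∩-contains : ∀ {k A B A′ B′} {G : Vec (Fin n) k} → Contains G A B → Contains G A′ B′ →
                 Contains G (A ∩ A′) (B ∩ B′)
    ∩-contains (G⊆A , c₀∈B) (G⊆A′ , c₀∈B′) =
      Vecᴬ.map x∈p∩q⁺ (Vecᴬ.zip (G⊆A , G⊆A′)) , x∈p∩q⁺ (c₀∈B , c₀∈B′)

    generates⊎grows : ∀ {k s} {G : Vec (Fin n) (suc k)} → Vecᴬ.All (_∈ R) G → ClosuresHave s G →
                      Generates G ⊎ ∃ λ r → r ∈ R × ClosuresHave (2 * s) (r ∷ G)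
    generates⊎grows {s = s} {G = G@(_ ∷ _)} G⊆R closures with escapes? G
    ... | no ¬escapes = inj₁ (¬escapes⇒generates ¬escapes)
    ... | yes (A , B , U , closed , contains@(G⊆A , _) , r , r∈R , r∉A) = inj₂ (r , r∈R , grown)
      where
        grown : ClosuresHave (2 * s) (r ∷ G)
        grown A′ B′ U′ closed′ (r∈A′ ∷ G⊆A′ , c₀∈B′) =
          doubling closed closed′ (Vecᴬ.head G⊆R) (Vecᴬ.head G⊆A) (Vecᴬ.head G⊆A′) r∈R r∉A r∈A′
            (closures (A ∩ A′) (B ∩ B′) (U ∩ U′) (∩-closed closed closed′)
                      (∩-contains contains (G⊆A′ , c₀∈B′)))

    Stage : ℕ → Set
    Stage i = Σ (Vec (Fin n) (suc i)) λ G → Vecᴬ.All (_∈ R) G × (Generates G ⊎ ClosuresHave (2 ^ i) G)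

    generating-stage : ∀ {i} (G : Vec (Fin n) (suc i)) → Vecᴬ.All (_∈ R) G → Generates G → Stage (suc i)
    generating-stage G@(g ∷ _) G⊆R@(g∈R ∷ _) generates =
      g ∷ G , g∈R ∷ G⊆R , inj₁ λ A B U closed (gG⊆A , c₀∈B) → generates A B U closed (Vecᴬ.tail gG⊆A , c₀∈B)

    next-stage : ∀ {i} → Stage i → Stage (suc i)
    next-stage (G , G⊆R , inj₁ generates) = generating-stage G G⊆R generates
    next-stage (G , G⊆R , inj₂ closures) with generates⊎grows G⊆R closures
    ... | inj₁ generates             = generating-stage G G⊆R generates
    ... | inj₂ (r , r∈R , closures′) = r ∷ G , r∈R ∷ G⊆R , inj₂ closures′

    stage : ∀ {r₀} → r₀ ∈ R → ∀ i → Stage i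
    stage {r₀} r₀∈R zero    = r₀ ∷ [] , r₀∈R ∷ [] , inj₂ λ A B U (_ , entry∈U , _) (r₀∈A , c₀∈B) →
      [ entry L r₀ c₀ ] , [] ∷ [] , entry∈U r₀ c₀ (Vecᴬ.head r₀∈A) c₀∈B ∷ [] , ≤-refl
    stage r₀∈R (suc i) = next-stage (stage r₀∈R i)

    generator : ∀ {K r₀} → c₀ ∈ S → r₀ ∈ R → ∣ symbols ∣ < 2 ^ suc K →
                Σ (Vec (Fin n) (suc K)) λ G → Vecᴬ.All (_∈ R) G × Generates G
    generator {K} c₀∈S r₀∈R small with stage r₀∈R K
    ... | G , G⊆R , inj₁ generates = G , G⊆R , generates
    ... | G , G⊆R , inj₂ closures with generates⊎grows G⊆R closures
    ...   | inj₁ generates             = G , G⊆R , generates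
    ...   | inj₂ (r , r∈R , closures′) =
      contradiction (closuresHave⇒≤∣symbols∣ c₀∈S (r∈R ∷ G⊆R) closures′) (<⇒≱ small)

module _ {n : ℕ} {L : LatinSquare n} {R S R′ S′ : Subset n}
         (Q : LatinSubmatrix L R S) (Q′ : LatinSubmatrix L R′ S′) where
  private
    module Q  = LatinSubmatrix Q
    module Q′ = LatinSubmatrix Q′
  open Closure Q

  Q∩Q′-closed : Closed (R ∩ R′) (S ∩ S′) (Q.symbols ∩ Q′.symbols)
  Q∩Q′-closed =
      (λ t∈ → proj₁ (x∈p∩q⁻ Q.symbols Q′.symbols t∈))
    , (λ r c r∈ c∈ → let r∈R , r∈R′ = x∈p∩q⁻ R R′ r∈ ; c∈S , c∈S′ = x∈p∩q⁻ S S′ c∈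
                     in x∈p∩q⁺ (Q.entry∈symbols r∈R c∈S , Q′.entry∈symbols r∈R′ c∈S′))
    , (λ r c r∈ c∈S t∈ → x∈p∩q⁺ (c∈S , Q′.column∈S (proj₂ (x∈p∩q⁻ R R′ r∈))
                                                    (proj₂ (x∈p∩q⁻ Q.symbols Q′.symbols t∈))))
    , (λ r c c∈ r∈R t∈ → x∈p∩q⁺ (r∈R , Q′.row∈R (proj₂ (x∈p∩q⁻ S S′ c∈))
                                                 (proj₂ (x∈p∩q⁻ Q.symbols Q′.symbols t∈))))

  generated-⊆ : ∀ {k c₀} {G : Vec (Fin n) (suc k)} → c₀ ∈ S → c₀ ∈ S′ →
                Vecᴬ.All (_∈ R) G → Vecᴬ.All (_∈ R′) G → Generation.Generates c₀ G →
                R ⊆ R′ × S ⊆ S′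
  generated-⊆ {c₀ = c₀} {G = G@(_ ∷ _)} c₀∈S c₀∈S′ G⊆R G⊆R′ generates =
    (proj₂ ∘ x∈p∩q⁻ R R′ ∘ R⊆R∩R′) , (proj₂ ∘ x∈p∩q⁻ S S′ ∘ S⊆S∩S′)
    where
      c₀∈S∩S′ : c₀ ∈ S ∩ S′
      c₀∈S∩S′ = x∈p∩q⁺ (c₀∈S , c₀∈S′)
      G⊆R∩R′ : Vecᴬ.All (_∈ R ∩ R′) G
      G⊆R∩R′ = Vecᴬ.map x∈p∩q⁺ (Vecᴬ.zip (G⊆R , G⊆R′))
      R⊆R∩R′ : R ⊆ R ∩ R′
      R⊆R∩R′ = generates _ _ _ Q∩Q′-closed (G⊆R∩R′ , c₀∈S∩S′)
      S⊆S∩S′ : S ⊆ S ∩ S′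
      S⊆S∩S′ = rows⊆⇒columns⊆ Q∩Q′-closed (Vecᴬ.head G⊆R) (Vecᴬ.head G⊆R∩R′) c₀∈S c₀∈S∩S′ R⊆R∩R′

data Spanned {n k} {L : LatinSquare n} {R S : Subset n} (Q : LatinSubmatrix L R S) :
             Vec (Fin n) (suc (suc k)) → Set where
  spanned : ∀ {c₀ G} → c₀ ∈ S → Vecᴬ.All (_∈ R) G → Closure.Generation.Generates Q c₀ G →
            Spanned Q (c₀ ∷ G)

spanned-unique : ∀ {n k} {L : LatinSquare n} {R S R′ S′ : Subset n}
                 {Q : LatinSubmatrix L R S} {Q′ : LatinSubmatrix L R′ S′} {v : Vec (Fin n) (suc (suc k))} →
                 Spanned Q v → Spanned Q′ v → (R , S) ≡ (R′ , S′)
spanned-unique {Q = Q} {Q′} (spanned c₀∈S G⊆R generates) (spanned c₀∈S′ G⊆R′ generates′) =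
  let R⊆R′ , S⊆S′ = generated-⊆ Q Q′ c₀∈S c₀∈S′ G⊆R G⊆R′ generates
      R′⊆R , S′⊆S = generated-⊆ Q′ Q c₀∈S′ c₀∈S G⊆R′ G⊆R generates′
  in cong₂ _,_ (⊆-antisym R⊆R′ R′⊆R) (⊆-antisym S⊆S′ S′⊆S)

module _ {n : ℕ} (L : LatinSquare n) {m K : ℕ} (1≤m : 1 ≤ m) (m<2^[1+K] : m < 2 ^ suc K) where

  spanning-sequence : ∀ {x} (Q : IsSubsquare L m x) →
                      Σ (Vec (Fin n) (suc (suc K))) (Spanned (isSubsquare⇒latinSubmatrix L Q))
  spanning-sequence {R , S} Q@(∣R∣≡m , ∣S∣≡m , _ , ∣T∣≡m , _) =
    let c₀ , c₀∈S     = nonempty S (subst (1 ≤_) (sym ∣S∣≡m) 1≤m)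
        r₀ , r₀∈R     = nonempty R (subst (1 ≤_) (sym ∣R∣≡m) 1≤m)
        G , G⊆R , gen = Closure.Generation.generator (isSubsquare⇒latinSubmatrix L Q) c₀ c₀∈S r₀∈R
                          (subst (_< 2 ^ suc K) (sym ∣T∣≡m) m<2^[1+K])
    in c₀ ∷ G , spanned c₀∈S G⊆R gen

  code : ∀ {x} → IsSubsquare L m x → Fin (n ^ suc (suc K))
  code Q = encode (proj₁ (spanning-sequence Q))

  code-injective : ∀ {x y} (Q : IsSubsquare L m x) (Q′ : IsSubsquare L m y) → code Q ≡ code Q′ → x ≡ y
  code-injective {x} {y} Q Q′ eq =
    same-sequence⇒same (spanning-sequence Q) (spanning-sequence Q′) (encode-injective eq)
    where
      same-sequence⇒same : (s : Σ (Vec (Fin n) (suc (suc K))) (Spanned (isSubsquare⇒latinSubmatrix L Q)))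
                           (s′ : Σ (Vec (Fin n) (suc (suc K))) (Spanned (isSubsquare⇒latinSubmatrix L Q′))) →
                           proj₁ s ≡ proj₁ s′ → x ≡ y
      same-sequence⇒same (_ , spans) (_ , spans′) refl = spanned-unique spans spans′

  subsquares-≤ : ∀ {xs} → Unique xs → All (IsSubsquare L m) xs → length xs ≤ n ^ suc (suc K)
  subsquares-≤ xs-unique subsquares =
    subst (_ ≤_) (length-tabulate id)
      (injection⇒length≤ code code-injective xs-unique subsquares λ _ _ → ∈-allFin _)

corollary2p3 : (m : ℕ) → 1 ≤ m →
    ∃ λ (C : ℕ) → (n : ℕ) → m ≤ n → (L : LatinSquare n) →
      (xs : List (Subset n × Subset n)) → Unique xs → All (IsSubsquare L m) xs →
      (p q : ℕ) → 1 ≤ q → 2 * m * (q * q) ≤ p * p →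
      length xs ^ q ≤ C ^ q * n ^ (p + 2 * q)
corollary2p3 m 1≤m = 1 , λ n m≤n L xs xs-unique subsquares p q _ 2mq²≤p² →
  let K , 2^K≤m , m<2^[1+K] = ∃2^K≤m<2^[1+K] m 1≤m
      instance _ = >-nonZero (≤-trans 1≤m m≤n)
  in begin
    length xs ^ q          ≤⟨ ^-monoˡ-≤ q (subsquares-≤ L {K = K} 1≤m m<2^[1+K] xs-unique subsquares) ⟩
    (n ^ (2 + K)) ^ q      ≡⟨ ^-*-assoc n (2 + K) q ⟩
    n ^ ((2 + K) * q)      ≤⟨ ^-monoʳ-≤ n (exponent-bound {K = K} {p} {q} 2^K≤m 2mq²≤p²) ⟩
    n ^ (p + 2 * q)        ≡⟨ sym (*-identityˡ _) ⟩
    1 * n ^ (p + 2 * q)    ≡⟨ cong (_* n ^ (p + 2 * q)) (sym (^-zeroˡ q)) ⟩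
    1 ^ q * n ^ (p + 2 * q) ∎
  where open ≤-Reasoning
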